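{- Let $q\geq 2$ and let $C$ be a completely regular code in $H(3,q)$ with covering radius $1$, eigenvalue $\lambda_2(3,q)$ and odd parameter $\gamma$ with $\gamma<q/2$. Then $C$ fulfills the strong clique property, and $C$ is obtained by Construction D.
   Context: Let $\mathcal{A}$ be a set of size $q\geq 2$; $H(3,q)$ has vertex set $\mathcal{A}^3$, tuples adjacent iff they differ in exactly one position; $\lambda_2(3,q)=q-3$. A set $C$ of vertices is a completely regular code with covering radius $1$ if $C$ is a nonempty proper subset and there are integers $\beta,\gamma\geq1$ such that every vertex of $C$ has exactly $\beta$ neighbours outside $C$ and every vertex outside $C$ has exactly $\gamma$ neighbours in $C$; it has eigenvalue $\lambda_2(3,q)$ iff $3(q-1)-(\beta+\gamma)=q-3$, i.e. $\beta+\gamma=2q$. A maximum clique of codirection $i\in\{1,2,3\}$ in $H(3,q)$ is a set of $q$ tuples that agree in all positions except position $i$ and take all $q$ symbols in position $i$. $C$ fulfills the clique property if $C$ is a union of pairwise disjoint maximum cliques; it fulfills the strong clique property if moreover among these cliques there are cliques of each of the three codirections. For $X\subseteq\mathcal{A}$ write $\overline{X}=\mathcal{A}\setminus X$. Construction D: a set $C\subseteq\mathcal{A}^3$ is obtained by Construction D if there are nonempty proper subsets $R,S,T$ of $\mathcal{A}$, positive integers $a,b,c$, and sets $D^1\subseteq S\times T$, $D^2\subseteq R\times\overline{T}$, $D^3\subseteq\overline{R}\times\overline{S}$ such that: $|D^1\cap (S\times\{v\})|=a$ for all $v\in T$ and $|D^1\cap(\{u\}\times T)|=b$ for all $u\in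 S$; $|D^2\cap (R\times\{v\})|=a$ for all $v\in \overline T$ and $|D^2\cap(\{u\}\times \overline T)|=c$ for all $u\in R$; $|D^3\cap (\overline R\times\{v\})|=b$ for all $v\in \overline S$ and $|D^3\cap(\{u\}\times \overline S)|=c$ for all $u\in \overline R$; and $C=\{x: (x_2,x_3)\in D^1\}\cup\{x:(x_1,x_3)\in D^2\}\cup\{x:(x_1,x_2)\in D^3\}$. -}

module Defs where

open import Data.Nat using (ℕ; zero; suc; _+_; _*_; _≡ᵇ_)
open import Data.Fin using (Fin; zero; suc; _≟_)
open import Data.Bool using (Bool; true; false; if_then_else_; _∧_; not)
open import Data.Product using (Σ; ∃; ∃-syntax; _×_; _,_)
open import Data.Sum using (_⊎_)
open import Relation.Nullary using (¬_; does)
open import Relation.Binary.PropositionalEquality using (_≡_; _≢_)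
open import Function using (_∘_; _⇔_)

Vertex : ℕ → Set
Vertex q = Fin q × Fin q × Fin q

sumFin : ∀ {n} → (Fin n → ℕ) → ℕ
sumFin {zero}  f = 0
sumFin {suc n} f = f zero + sumFin (f ∘ suc)

count : ∀ {n} → (Fin n → Bool) → ℕ
count f = sumFin (λ i → if f i then 1 else 0)

countV : ∀ {q} → (Vertex q → Bool) → ℕ
countV f = sumFin (λ a → sumFin (λ b → count (λ c → f (a , b , c))))

neq : ∀ {q} → Fin q → Fin q → ℕ
neq a b = if does (a ≟ b) then 0 else 1

hamming : ∀ {q} → Vertex q → Vertex q → ℕ
hamming (x1 , x2 , x3) (y1 , y2 , y3) = neq x1 y1 + neq x2 y2 + neq x3 y3

adjacent : ∀ {q} → Vertex q → Vertex q → Bool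
adjacent x y = hamming x y ≡ᵇ 1

Code : ℕ → Set
Code q = Vertex q → Bool

outNbrs : ∀ {q} → Code q → Vertex q → ℕ
outNbrs C x = countV (λ y → adjacent x y ∧ not (C y))

inNbrs : ∀ {q} → Code q → Vertex q → ℕ
inNbrs C x = countV (λ y → adjacent x y ∧ C y)

record IsCRC1 {q : ℕ} (C : Code q) (β γ : ℕ) : Set where
  field
    nonempty : ∃[ x ] C x ≡ true
    proper   : ∃[ x ] C x ≡ false
    β≥1      : 1 Data.Nat.≤ β
    γ≥1      : 1 Data.Nat.≤ γ
    βreg     : ∀ x → C x ≡ true  → outNbrs C x ≡ β
    γreg     : ∀ x → C x ≡ false → inNbrs C x ≡ γ

-- Maximum cliques of H(3,q): a maximum clique of codirection i consists of the
-- q tuples that agree with fixed values in the two positions other than i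
-- and take all q symbols in position i.  It is given by its codirection and
-- the two fixed values (in increasing order of position).
record MaxClique (q : ℕ) : Set where
  constructor clique
  field
    codir : Fin 3
    fixA  : Fin q
    fixB  : Fin q

open MaxClique public

_∈K_ : ∀ {q} → Vertex q → MaxClique q → Set
(x1 , x2 , x3) ∈K clique zero a b = x2 ≡ a × x3 ≡ b
(x1 , x2 , x3) ∈K clique (suc zero) a b = x1 ≡ a × x3 ≡ b
(x1 , x2 , x3) ∈K clique (suc (suc zero)) a b = x1 ≡ a × x2 ≡ b

IsCliqueUnion : ∀ {q} → Code q → (m : ℕ) → (Fin m → MaxClique q) → Set
IsCliqueUnion {q} C m K =
  (∀ i j → i ≢ j → ∀ (x : Vertex q) → ¬ (x ∈K K i × x ∈K K j)) ×
  (∀ (x : Vertex q) → (C x ≡ true ⇔ (∃[ i ] x ∈K K i)))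

CliqueProperty : ∀ {q} → Code q → Set
CliqueProperty {q} C = ∃[ m ] Σ (Fin m → MaxClique q) λ K → IsCliqueUnion C m K

StrongCliqueProperty : ∀ {q} → Code q → Set
StrongCliqueProperty {q} C =
  ∃[ m ] Σ (Fin m → MaxClique q) λ K →
    IsCliqueUnion C m K × (∀ (d : Fin 3) → ∃[ i ] codir (K i) ≡ d)

Subset : ℕ → Set
Subset q = Fin q → Bool

compl : ∀ {q} → Subset q → Subset q
compl X u = not (X u)

NonemptyProper : ∀ {q} → Subset q → Set
NonemptyProper X = (∃[ u ] X u ≡ true) × (∃[ u ] X u ≡ false)

Biregular : ∀ {q} → (X Y : Subset q) → (D : Fin q → Fin q → Bool) → (r s : ℕ) → Set
Biregular X Y D r s =
  (∀ u v → D u v ≡ true → (X u ≡ true × Y v ≡ true)) ×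
  (∀ v → Y v ≡ true → count (λ u → X u ∧ D u v) ≡ r) ×
  (∀ u → X u ≡ true → count (λ v → Y v ∧ D u v) ≡ s)

ConstructionD : ∀ {q} → Code q → Set
ConstructionD {q} C =
  Σ (Subset q) λ R → Σ (Subset q) λ S → Σ (Subset q) λ T →
  NonemptyProper R × NonemptyProper S × NonemptyProper T ×
  Σ ℕ λ a → Σ ℕ λ b → Σ ℕ λ c →
  1 Data.Nat.≤ a × 1 Data.Nat.≤ b × 1 Data.Nat.≤ c ×
  Σ (Fin q → Fin q → Bool) λ D1 →
  Σ (Fin q → Fin q → Bool) λ D2 →
  Σ (Fin q → Fin q → Bool) λ D3 →
  Biregular S T D1 a b ×
  Biregular R (compl T) D2 a c ×
  Biregular (compl R) (compl S) D3 b c ×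
  (∀ (x1 x2 x3 : Fin q) →
     C (x1 , x2 , x3) ≡ true ⇔
       (D1 x2 x3 ≡ true ⊎ D2 x1 x3 ≡ true ⊎ D3 x1 x2 ≡ true))

-- Counting neighbours along the three lines through a vertex x shows that these lines
-- together contain γ + q·[x ∈ C] codewords. Applied at a non-codeword, a line not contained
-- in C carries at most γ codewords; as 2γ < q, every codeword then lies on exactly one full
-- line and C is the disjoint union of its full lines. Expanding the line sum through
-- (a, b, c) in terms of full lines, the numbers of full lines lying in the planes x₁ = a,
-- x₂ = b and x₃ = c add up to γ, so each is a constant c₀, b₀, a₀. Writing Nᵢ for the number
-- of full lines of codirection i, this gives N₁ + N₂ = q a₀, N₁ + N₃ = q b₀ and
-- N₂ + N₃ = q c₀ with a₀ + b₀ + c₀ = γ odd, so every codirection occurs. Finally, full lines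
-- of different codirections in one plane would meet, so each plane contains full lines of
-- only one of its two codirections; this splits the symbols into the sets R, S, T.

module Submission where

open import Defs
open import Data.Bool using (Bool; true; false; if_then_else_; _∧_; not)
open import Data.Bool.Properties using (not-injective) renaming (_≟_ to _≟ᵇ_)
open import Data.Empty using (⊥; ⊥-elim)
open import Data.Fin using (Fin; zero; suc; _≟_; fromℕ<)
open import Data.Fin.Patterns using (0F; 1F; 2F)
open import Data.List using (List; map; filter; cartesianProduct; allFin; length; lookup)
open import Data.List.Membership.Propositional using (_∈_)
open import Data.List.Membership.Propositional.Properties
  using (∈-filter⁺; ∈-filter⁻; ∈-lookup; ∈-cartesianProduct⁺; ∈-allFin; ∈-map⁺)
open import Data.List.Relation.Unary.All as All using ()
open import Data.List.Relation.Unary.AllPairs using (_∷_)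
open import Data.List.Relation.Unary.Any using (index)
open import Data.List.Relation.Unary.Any.Properties using (lookup-index)
open import Data.List.Relation.Unary.Unique.Propositional using (Unique)
import Data.List.Relation.Unary.Unique.Propositional.Properties as Unique
open import Data.Nat using (ℕ; zero; suc; _+_; _*_; _≤_; _<_; _%_; _≡ᵇ_; z≤n; s≤s; NonZero; >-nonZero; _<?_)
  renaming (_≟_ to _≟ℕ_)
open import Data.Nat.Properties hiding (_≟_)
open import Algebra.Properties.CommutativeSemigroup +-commutativeSemigroup using (interchange)
open import Data.Nat.DivMod using (m*n%n≡0)
open import Data.Nat.Tactic.RingSolver using (solve-∀)
open import Data.Product using (Σ; ∃-syntax; _×_; _,_; proj₁; proj₂)
open import Data.Sum using (_⊎_; inj₁; inj₂)
open import Function using (_∘_; _⇔_; mk⇔; Equivalence)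
open import Relation.Nullary using (¬_; Dec; does; yes; no)
open import Relation.Nullary.Decidable using (dec-true; dec-false)
open import Relation.Binary.PropositionalEquality

ind : Bool → ℕ
ind b = if b then 1 else 0

ind≤1 : ∀ b → ind b ≤ 1
ind≤1 true  = ≤-refl
ind≤1 false = z≤n

ind-∧ : ∀ a b → ind (a ∧ b) ≡ ind a * ind b
ind-∧ true  b = sym (+-identityʳ (ind b))
ind-∧ false b = refl

does⇒ : ∀ {P : Set} (d : Dec P) → does d ≡ true → P
does⇒ (yes p) _ = p

does⇒¬ : ∀ {P : Set} (d : Dec P) → does d ≡ false → ¬ P
does⇒¬ (no ¬p) _ = ¬p

sumFin-cong : ∀ {n} {f g : Fin n → ℕ} → (∀ i → f i ≡ g i) → sumFin f ≡ sumFin g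
sumFin-cong {zero}  _   = refl
sumFin-cong {suc n} f≗g = cong₂ _+_ (f≗g zero) (sumFin-cong (f≗g ∘ suc))

sumFin-mono-≤ : ∀ {n} {f g : Fin n → ℕ} → (∀ i → f i ≤ g i) → sumFin f ≤ sumFin g
sumFin-mono-≤ {zero}  _   = z≤n
sumFin-mono-≤ {suc n} f≤g = +-mono-≤ (f≤g zero) (sumFin-mono-≤ (f≤g ∘ suc))

sumFin-+ : ∀ {n} (f g : Fin n → ℕ) → sumFin (λ i → f i + g i) ≡ sumFin f + sumFin g
sumFin-+ {zero}  f g = refl
sumFin-+ {suc n} f g =
  trans (cong (f zero + g zero +_) (sumFin-+ (f ∘ suc) (g ∘ suc)))
        (interchange (f zero) (g zero) (sumFin (f ∘ suc)) (sumFin (g ∘ suc)))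

sumFin-+₃ : ∀ {n} (f g h : Fin n → ℕ) →
  sumFin (λ i → f i + g i + h i) ≡ sumFin f + sumFin g + sumFin h
sumFin-+₃ f g h = trans (sumFin-+ (λ i → f i + g i) h) (cong (_+ sumFin h) (sumFin-+ f g))

sumFin-*ˡ : ∀ {n} k (f : Fin n → ℕ) → sumFin (λ i → k * f i) ≡ k * sumFin f
sumFin-*ˡ {zero}  k f = sym (*-zeroʳ k)
sumFin-*ˡ {suc n} k f =
  trans (cong (k * f zero +_) (sumFin-*ˡ k (f ∘ suc))) (sym (*-distribˡ-+ k (f zero) _))

sumFin-const : ∀ {n} k → sumFin {n} (λ _ → k) ≡ n * k
sumFin-const {zero}  k = refl
sumFin-const {suc n} k = cong (k +_) (sumFin-const {n} k)

sumFin-zero : ∀ {n} → sumFin {n} (λ _ → 0) ≡ 0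
sumFin-zero {n} = trans (sumFin-const {n} 0) (*-zeroʳ n)

sumFin-constant : ∀ {n k} {f : Fin n → ℕ} → (∀ i → f i ≡ k) → sumFin f ≡ n * k
sumFin-constant {n} {k} f≡k = trans (sumFin-cong f≡k) (sumFin-const {n} k)

sumFin-swap : ∀ {m n} (f : Fin m → Fin n → ℕ) →
  sumFin (λ i → sumFin (f i)) ≡ sumFin (λ j → sumFin (λ i → f i j))
sumFin-swap {zero} {n} f = sym (sumFin-zero {n})
sumFin-swap {suc m} f =
  trans (cong (sumFin (f zero) +_) (sumFin-swap (f ∘ suc))) (sym (sumFin-+ (f zero) _))

sumFin-term≤ : ∀ {n} (f : Fin n → ℕ) i → f i ≤ sumFin f
sumFin-term≤ f zero    = m≤m+n _ _
sumFin-term≤ f (suc i) = ≤-trans (sumFin-term≤ (f ∘ suc) i) (m≤n+m _ _)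

sumFin-pos : ∀ {n} (f : Fin n → ℕ) → 0 < sumFin f → ∃[ i ] 0 < f i
sumFin-pos {suc n} f pos with f zero in f₀
... | suc _ = zero , subst (0 <_) (sym f₀) (s≤s z≤n)
... | zero  = let (i , fi) = sumFin-pos (f ∘ suc) pos in suc i , fi

sumFin-3 : (f : Fin 3 → ℕ) → sumFin f ≡ f 0F + f 1F + f 2F
sumFin-3 f = trans (cong (λ n → f 0F + (f 1F + n)) (+-identityʳ (f 2F))) (sym (+-assoc (f 0F) _ _))

δ : ∀ {n} → Fin n → Fin n → ℕ
δ i j = ind (does (i ≟ j))

sumFin-δ : ∀ {n} (k : Fin n) (f : Fin n → ℕ) → sumFin (λ i → δ k i * f i) ≡ f k
sumFin-δ {suc n} zero    f = trans (cong₂ _+_ (+-identityʳ (f zero)) (sumFin-zero {n})) (+-identityʳ (f zero))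
sumFin-δ {suc n} (suc k) f = sumFin-δ k (f ∘ suc)

count-cong : ∀ {n} {f g : Fin n → Bool} → (∀ i → f i ≡ g i) → count f ≡ count g
count-cong f≗g = sumFin-cong (cong ind ∘ f≗g)

count-pos : ∀ {n} (f : Fin n → Bool) → 0 < count f → ∃[ i ] f i ≡ true
count-pos {suc n} f pos with f zero in f₀
... | true  = zero , f₀
... | false = let (i , fi) = count-pos (f ∘ suc) pos in suc i , fi

witness⇒count-pos : ∀ {n} (f : Fin n → Bool) i → f i ≡ true → 0 < count f
witness⇒count-pos f zero    f₀ rewrite f₀ = s≤s z≤n
witness⇒count-pos f (suc i) fᵢ = ≤-trans (witness⇒count-pos (f ∘ suc) i fᵢ) (m≤n+m _ _)

no-witness⇒count≡0 : ∀ {n} (f : Fin n → Bool) → (∀ i → f i ≢ true) → count f ≡ 0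
no-witness⇒count≡0 f none = n≤0⇒n≡0 (≮⇒≥ λ pos → let (i , fi) = count-pos f pos in none i fi)

count≡0⇒none : ∀ {n} (f : Fin n → Bool) → count f ≡ 0 → ∀ i → f i ≡ false
count≡0⇒none f none i with f i in fᵢ
... | false = refl
... | true  = ⊥-elim (>⇒≢ (witness⇒count-pos f i fᵢ) none)

count-complement : ∀ {n} (f : Fin n → Bool) → count f + count (not ∘ f) ≡ n
count-complement {zero}  f = refl
count-complement {suc n} f with f zero
... | true  = cong suc (count-complement (f ∘ suc))
... | false = trans (+-suc _ _) (cong suc (count-complement (f ∘ suc)))

count≡n⇒all : ∀ {n} (f : Fin n → Bool) → count f ≡ n → ∀ i → f i ≡ true
count≡n⇒all f all i with f i in fᵢ
... | true  = refl
... | false = ⊥-elim (>⇒≢ (witness⇒count-pos (not ∘ f) i (cong not fᵢ)) none)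
  where
  none : count (not ∘ f) ≡ 0
  none = +-cancelˡ-≡ (count f) _ _ (trans (count-complement f) (trans (sym all) (sym (+-identityʳ _))))

count≢n⇒missing : ∀ {n} (f : Fin n → Bool) → count f ≢ n → ∃[ i ] f i ≡ false
count≢n⇒missing f notAll = i , not-injective {y = false} nfᵢ
  where
  some : count (not ∘ f) ≢ 0
  some none = notAll (trans (sym (+-identityʳ _)) (trans (cong (count f +_) (sym none)) (count-complement f)))
  i = proj₁ (count-pos (not ∘ f) (n≢0⇒n>0 some))
  nfᵢ = proj₂ (count-pos (not ∘ f) (n≢0⇒n>0 some))

count≤1-unique : ∀ {n} (f : Fin n → Bool) → count f ≤ 1 → ∀ {i j} → f i ≡ true → f j ≡ true → i ≡ j
count≤1-unique f le {zero}  {zero}  _  _  = refl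
count≤1-unique f le {zero}  {suc j} f₀ fⱼ =
  ⊥-elim (<⇒≱ (witness⇒count-pos (f ∘ suc) j fⱼ) (≤-pred (subst (λ b → ind b + count (f ∘ suc) ≤ 1) f₀ le)))
count≤1-unique f le {suc i} {zero}  fᵢ f₀ =
  ⊥-elim (<⇒≱ (witness⇒count-pos (f ∘ suc) i fᵢ) (≤-pred (subst (λ b → ind b + count (f ∘ suc) ≤ 1) f₀ le)))
count≤1-unique f le {suc i} {suc j} fᵢ fⱼ =
  cong suc (count≤1-unique (f ∘ suc) (≤-trans (m≤n+m _ _) le) fᵢ fⱼ)

count-∧-supported : ∀ {n} (X D : Fin n → Bool) → (∀ i → D i ≡ true → X i ≡ true) →
  count (λ i → X i ∧ D i) ≡ count D
count-∧-supported X D supp = count-cong λ i → ∧-supported (X i) (D i) (supp i)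
  where
  ∧-supported : ∀ x d → (d ≡ true → x ≡ true) → x ∧ d ≡ d
  ∧-supported true  d     _ = refl
  ∧-supported false false _ = refl
  ∧-supported false true  h with h refl
  ... | ()

full-summands-≤ : ∀ {n} q (f : Fin n → ℕ) → q * count (λ i → does (f i ≟ℕ q)) ≤ sumFin f
full-summands-≤ {zero}  q f = ≤-reflexive (*-zeroʳ q)
full-summands-≤ {suc n} q f = step (f zero ≟ℕ q)
  where
  rest = full-summands-≤ q (f ∘ suc)
  step : (d : Dec (f zero ≡ q)) →
    q * (ind (does d) + count (λ i → does (f (suc i) ≟ℕ q))) ≤ f zero + sumFin (f ∘ suc)
  step (yes f₀≡q) = ≤-trans (≤-reflexive (*-suc q _)) (+-mono-≤ (≤-reflexive (sym f₀≡q)) rest)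
  step (no _)     = ≤-trans rest (m≤n+m _ _)

full-summands : ∀ {q γ} → 2 * γ < q → (f : Fin 3 → ℕ) → (∀ i → f i ≢ q → f i ≤ γ) →
  ∀ b → sumFin f ≡ γ + q * ind b → count (λ i → does (f i ≟ℕ q)) ≡ ind b
full-summands {q} {γ} 2γ<q f small b sum≡ =
  count≡ (count (λ i → does (f i ≟ℕ q))) b
    (subst (q * count (λ i → does (f i ≟ℕ q)) ≤_) sum≡ (full-summands-≤ q f))
    (λ none → subst (_≤ 3 * γ) sum≡ (sumFin-mono-≤ λ i → small i (does⇒¬ (f i ≟ℕ q) (count≡0⇒none (λ i → does (f i ≟ℕ q)) none i))))
  where
  γ<q : γ < q
  γ<q = ≤-trans (s≤s (m≤m+n γ (γ + 0))) 2γ<q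

  count≡ : ∀ F b → q * F ≤ γ + q * ind b → (F ≡ 0 → γ + q * ind b ≤ 3 * γ) → F ≡ ind b
  count≡ zero          false _     _     = refl
  count≡ (suc zero)    true  _     _     = refl
  count≡ zero          true  _     upper =
    ⊥-elim (<⇒≱ 2γ<q (subst (_≤ 2 * γ) (*-identityʳ q) (+-cancelˡ-≤ γ _ _ (upper refl))))
  count≡ (suc F)       false lower _     =
    ⊥-elim (<⇒≱ γ<q (≤-trans (m≤m*n q (suc F))
      (subst (q * suc F ≤_) (trans (cong (γ +_) (*-zeroʳ q)) (+-identityʳ γ)) lower)))
  count≡ (suc (suc F)) true  lower _     =
    ⊥-elim (<⇒≱ γ<q (+-cancelʳ-≤ q q γ (begin
      q + q               ≤⟨ +-monoʳ-≤ q (m≤m*n q (suc F)) ⟩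
      q + q * suc F       ≡⟨ sym (*-suc q (suc F)) ⟩
      q * suc (suc F)     ≤⟨ lower ⟩
      γ + q * 1           ≡⟨ cong (γ +_) (*-identityʳ q) ⟩
      γ + q               ∎)))
    where open ≤-Reasoning

positive-quotient : ∀ q {x y a} → 0 < x → x + y ≡ q * a → 0 < a
positive-quotient q {a = zero}  0<x x+y≡0 = ⊥-elim (>⇒≢ 0<x (m+n≡0⇒m≡0 _ (trans x+y≡0 (*-zeroʳ q))))
positive-quotient q {a = suc _} _   _     = s≤s z≤n

-- z = 0 would force a = b + c, making a + b + c even.
pairwise-sums-positive : ∀ q .{{_ : NonZero q}} {x y z a b c} →
  x + y ≡ q * a → x + z ≡ q * b → y + z ≡ q * c → (a + b + c) % 2 ≡ 1 →
  0 < x × 0 < y × 0 < z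
pairwise-sums-positive q {x} {y} {z} {a} {b} {c} xy xz yz odd =
  third-positive yz (trans (+-comm y x) xy) (trans (+-comm z x) xz) (trans (cong (_% 2) (rotate a b c)) odd) ,
  third-positive xz xy (trans (+-comm z y) yz) (trans (cong (_% 2) (swap a b c)) odd) ,
  third-positive xy xz yz odd
  where
  rotate : ∀ a b c → c + a + b ≡ a + b + c
  rotate = solve-∀
  swap : ∀ a b c → b + a + c ≡ a + b + c
  swap = solve-∀
  double : ∀ b c → b + c + b + c ≡ (b + c) * 2
  double = solve-∀

  split-even : ∀ {x y a b c} → x + y ≡ q * a → x ≡ q * b → y ≡ q * c → (a + b + c) % 2 ≡ 0
  split-even {a = a} {b} {c} xy refl refl = begin
    (a + b + c) % 2           ≡⟨ cong (λ a → (a + b + c) % 2) a≡b+c ⟩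
    (b + c + b + c) % 2       ≡⟨ cong (_% 2) (double b c) ⟩
    ((b + c) * 2) % 2         ≡⟨ m*n%n≡0 (b + c) 2 ⟩
    0                         ∎
    where
    open ≡-Reasoning
    a≡b+c : a ≡ b + c
    a≡b+c = *-cancelˡ-≡ a (b + c) q (trans (sym xy) (sym (*-distribˡ-+ q b c)))

  third-positive : ∀ {x y z a b c} → x + y ≡ q * a → x + z ≡ q * b → y + z ≡ q * c → (a + b + c) % 2 ≡ 1 → 0 < z
  third-positive {x} {y} {z} xy xz yz odd = n≢0⇒n>0 λ z≡0 →
    0≢1+n (trans (sym (split-even xy (drop z≡0 xz) (drop z≡0 yz))) odd)
    where
    drop : ∀ {u v} → z ≡ 0 → u + z ≡ v → u ≡ v
    drop {u} refl u+0≡v = trans (sym (+-identityʳ u)) u+0≡v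

module _ {q : ℕ} where

  point : MaxClique q → Fin q → Vertex q
  point (clique 0F a b) t = t , a , b
  point (clique 1F a b) t = a , t , b
  point (clique 2F a b) t = a , b , t

  line : Fin 3 → Vertex q → MaxClique q
  line 0F (x₁ , x₂ , x₃) = clique 0F x₂ x₃
  line 1F (x₁ , x₂ , x₃) = clique 1F x₁ x₃
  line 2F (x₁ , x₂ , x₃) = clique 2F x₁ x₂

  ∈-line : ∀ d x → x ∈K line d x
  ∈-line 0F _ = refl , refl
  ∈-line 1F _ = refl , refl
  ∈-line 2F _ = refl , refl

  line-∈ : ∀ K {x} → x ∈K K → line (codir K) x ≡ K
  line-∈ (clique 0F _ _) (refl , refl) = refl
  line-∈ (clique 1F _ _) (refl , refl) = refl
  line-∈ (clique 2F _ _) (refl , refl) = refl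

  line-point : ∀ K t → line (codir K) (point K t) ≡ K
  line-point (clique 0F _ _) _ = refl
  line-point (clique 1F _ _) _ = refl
  line-point (clique 2F _ _) _ = refl

  ∈-point : ∀ K {x} → x ∈K K → ∃[ t ] point K t ≡ x
  ∈-point (clique 0F _ _) {t , _ , _} (refl , refl) = t , refl
  ∈-point (clique 1F _ _) {_ , t , _} (refl , refl) = t , refl
  ∈-point (clique 2F _ _) {_ , _ , t} (refl , refl) = t , refl

  lineCount : Code q → MaxClique q → ℕ
  lineCount C K = count (λ t → C (point K t))

  lineSum : Code q → Vertex q → ℕ
  lineSum C x = sumFin (λ d → lineCount C (line d x))

  Cube : Set
  Cube = Fin q → Fin q → Fin q → ℕ

  Σ³ : Cube → ℕ
  Σ³ F = sumFin λ a → sumFin λ b → sumFin λ c → F a b c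

  Σ³-cong : ∀ {F G : Cube} → (∀ a b c → F a b c ≡ G a b c) → Σ³ F ≡ Σ³ G
  Σ³-cong F≗G = sumFin-cong λ a → sumFin-cong λ b → sumFin-cong λ c → F≗G a b c

  Σ³-+ : ∀ (F G : Cube) → Σ³ (λ a b c → F a b c + G a b c) ≡ Σ³ F + Σ³ G
  Σ³-+ F G = trans
    (sumFin-cong λ a → trans (sumFin-cong λ b → sumFin-+ (F a b) (G a b))
                             (sumFin-+ (λ b → sumFin (F a b)) (λ b → sumFin (G a b))))
    (sumFin-+ (λ a → sumFin λ b → sumFin (F a b)) (λ a → sumFin λ b → sumFin (G a b)))

  Σ³-*ˡ : ∀ k (F : Cube) → Σ³ (λ a b c → k * F a b c) ≡ k * Σ³ F
  Σ³-*ˡ k F = trans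
    (sumFin-cong λ a → trans (sumFin-cong λ b → sumFin-*ˡ k (F a b)) (sumFin-*ˡ k (λ b → sumFin (F a b))))
    (sumFin-*ˡ k (λ a → sumFin λ b → sumFin (F a b)))

  Σ³-δ₂δ₃ : ∀ x₂ x₃ (F : Cube) → Σ³ (λ a b c → δ x₂ b * (δ x₃ c * F a b c)) ≡ sumFin (λ a → F a x₂ x₃)
  Σ³-δ₂δ₃ x₂ x₃ F = sumFin-cong λ a →
    trans (sumFin-cong λ b → trans (sumFin-*ˡ (δ x₂ b) (λ c → δ x₃ c * F a b c)) (cong (δ x₂ b *_) (sumFin-δ x₃ (F a b))))
          (sumFin-δ x₂ (λ b → F a b x₃))

  Σ³-δ₁δ₃ : ∀ x₁ x₃ (F : Cube) → Σ³ (λ a b c → δ x₁ a * (δ x₃ c * F a b c)) ≡ sumFin (λ b → F x₁ b x₃)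
  Σ³-δ₁δ₃ x₁ x₃ F = trans
    (sumFin-cong λ a →
      trans (sumFin-cong λ b → trans (sumFin-*ˡ (δ x₁ a) (λ c → δ x₃ c * F a b c))
                                     (cong (δ x₁ a *_) (sumFin-δ x₃ (F a b))))
            (sumFin-*ˡ (δ x₁ a) (λ b → F a b x₃)))
    (sumFin-δ x₁ (λ a → sumFin (λ b → F a b x₃)))

  Σ³-δ₁δ₂ : ∀ x₁ x₂ (F : Cube) → Σ³ (λ a b c → δ x₁ a * (δ x₂ b * F a b c)) ≡ sumFin (λ c → F x₁ x₂ c)
  Σ³-δ₁δ₂ x₁ x₂ F = trans
    (sumFin-cong λ a →
      trans (sumFin-cong λ b → trans (sumFin-*ˡ (δ x₁ a) (λ c → δ x₂ b * F a b c))
                                     (cong (δ x₁ a *_) (sumFin-*ˡ (δ x₂ b) (F a b))))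
            (trans (sumFin-*ˡ (δ x₁ a) (λ b → δ x₂ b * sumFin (F a b)))
                   (cong (δ x₁ a *_) (sumFin-δ x₂ (λ b → sumFin (F a b))))))
    (sumFin-δ x₁ (λ a → sumFin (F a x₂)))

-- Each neighbour of x lies on exactly one line through x, and x itself on all three.
lines-cover : ∀ p₁ p₂ p₃ →
  ind ((if p₁ then 0 else 1) + (if p₂ then 0 else 1) + (if p₃ then 0 else 1) ≡ᵇ 1)
    + 3 * (ind p₁ * (ind p₂ * ind p₃))
  ≡ ind p₂ * ind p₃ + ind p₁ * ind p₃ + ind p₁ * ind p₂
lines-cover true  true  true  = refl
lines-cover true  true  false = refl
lines-cover true  false true  = refl
lines-cover true  false false = refl
lines-cover false true  true  = refl
lines-cover false true  false = refl
lines-cover false false true  = refl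
lines-cover false false false = refl

neighbours : ∀ {q} (B : Code q) x → countV (λ y → adjacent x y ∧ B y) + 3 * ind (B x) ≡ lineSum B x
neighbours {q} B (x₁ , x₂ , x₃) = begin
  Σ³ α + 3 * ind (B x)                              ≡⟨ cong (λ n → Σ³ α + 3 * n) (sym at-x) ⟩
  Σ³ α + 3 * Σ³ ε                                   ≡⟨ sym (trans (Σ³-+ α (λ a b c → 3 * ε a b c)) (cong (Σ³ α +_) (Σ³-*ˡ 3 ε))) ⟩
  Σ³ (λ a b c → α a b c + 3 * ε a b c)              ≡⟨ Σ³-cong pointwise ⟩
  Σ³ (λ a b c → σ₁ a b c + σ₂ a b c + σ₃ a b c)     ≡⟨ trans (Σ³-+ (λ a b c → σ₁ a b c + σ₂ a b c) σ₃) (cong (_+ Σ³ σ₃) (Σ³-+ σ₁ σ₂)) ⟩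
  Σ³ σ₁ + Σ³ σ₂ + Σ³ σ₃                             ≡⟨ cong₂ _+_ (cong₂ _+_ (Σ³-δ₂δ₃ x₂ x₃ β) (Σ³-δ₁δ₃ x₁ x₃ β)) (Σ³-δ₁δ₂ x₁ x₂ β) ⟩
  sumFin (λ a → β a x₂ x₃) + sumFin (λ b → β x₁ b x₃) + sumFin (λ c → β x₁ x₂ c)
                                                    ≡⟨ sym (sumFin-3 (λ d → lineCount B (line d x))) ⟩
  lineSum B x                                       ∎
  where
  open ≡-Reasoning
  x : Vertex q
  x = x₁ , x₂ , x₃
  α β ε σ₁ σ₂ σ₃ : Cube
  α a b c = ind (adjacent x (a , b , c) ∧ B (a , b , c))
  β a b c = ind (B (a , b , c))
  ε a b c = δ x₁ a * (δ x₂ b * (δ x₃ c * β a b c))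
  σ₁ a b c = δ x₂ b * (δ x₃ c * β a b c)
  σ₂ a b c = δ x₁ a * (δ x₃ c * β a b c)
  σ₃ a b c = δ x₁ a * (δ x₂ b * β a b c)

  at-x : Σ³ ε ≡ ind (B x)
  at-x = trans (Σ³-δ₁δ₂ x₁ x₂ (λ a b c → δ x₃ c * β a b c)) (sumFin-δ x₃ (β x₁ x₂))

  distrib : ∀ A d₁ d₂ d₃ e → A * e + 3 * (d₁ * (d₂ * (d₃ * e))) ≡ (A + 3 * (d₁ * (d₂ * d₃))) * e
  distrib = solve-∀
  distrib′ : ∀ d₁ d₂ d₃ e → (d₂ * d₃ + d₁ * d₃ + d₁ * d₂) * e ≡ d₂ * (d₃ * e) + d₁ * (d₃ * e) + d₁ * (d₂ * e)
  distrib′ = solve-∀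

  pointwise : ∀ a b c → α a b c + 3 * ε a b c ≡ σ₁ a b c + σ₂ a b c + σ₃ a b c
  pointwise a b c = begin
    α a b c + 3 * ε a b c
      ≡⟨ cong (_+ 3 * ε a b c) (ind-∧ (adjacent x (a , b , c)) (B (a , b , c))) ⟩
    ind (adjacent x (a , b , c)) * β a b c + 3 * ε a b c
      ≡⟨ distrib (ind (adjacent x (a , b , c))) (δ x₁ a) (δ x₂ b) (δ x₃ c) (β a b c) ⟩
    (ind (adjacent x (a , b , c)) + 3 * (δ x₁ a * (δ x₂ b * δ x₃ c))) * β a b c
      ≡⟨ cong (_* β a b c) (lines-cover (does (x₁ ≟ a)) (does (x₂ ≟ b)) (does (x₃ ≟ c))) ⟩
    (δ x₂ b * δ x₃ c + δ x₁ a * δ x₃ c + δ x₁ a * δ x₂ b) * β a b c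
      ≡⟨ distrib′ (δ x₁ a) (δ x₂ b) (δ x₃ c) (β a b c) ⟩
    σ₁ a b c + σ₂ a b c + σ₃ a b c ∎

lineSum-complement : ∀ {q} (C : Code q) x → lineSum C x + lineSum (not ∘ C) x ≡ 3 * q
lineSum-complement {q} C x = begin
  lineSum C x + lineSum (not ∘ C) x
    ≡⟨ sym (sumFin-+ (λ d → lineCount C (line d x)) (λ d → lineCount (not ∘ C) (line d x))) ⟩
  sumFin (λ d → lineCount C (line d x) + lineCount (not ∘ C) (line d x))
    ≡⟨ sumFin-cong (λ d → count-complement (λ t → C (point (line d x) t))) ⟩
  sumFin {3} (λ _ → q)
    ≡⟨ sumFin-const {3} q ⟩
  3 * q ∎
  where open ≡-Reasoning

lineSum-crc : ∀ {q} {C : Code q} {β γ} → IsCRC1 C β γ → β + γ ≡ 2 * q →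
  ∀ x → lineSum C x ≡ γ + q * ind (C x)
lineSum-crc {q} {C} {β} {γ} crc β+γ≡2q x with C x in Cx
... | false = begin
  lineSum C x                    ≡⟨ sym (neighbours C x) ⟩
  inNbrs C x + 3 * ind (C x)     ≡⟨ cong₂ (λ n b → n + 3 * ind b) (γreg x Cx) Cx ⟩
  γ + 0                          ≡⟨ cong (γ +_) (sym (*-zeroʳ q)) ⟩
  γ + q * 0                      ∎
  where open ≡-Reasoning; open IsCRC1 crc
... | true = +-cancelʳ-≡ β _ _ (begin
  lineSum C x + β                         ≡⟨ cong (lineSum C x +_) (sym outside) ⟩
  lineSum C x + lineSum (not ∘ C) x      ≡⟨ lineSum-complement C x ⟩
  3 * q                                   ≡⟨ +-comm q (2 * q) ⟩
  2 * q + q                               ≡⟨ cong (_+ q) (sym β+γ≡2q) ⟩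
  β + γ + q                               ≡⟨ rearrange β γ q ⟩
  γ + q * 1 + β                           ∎)
  where
  open ≡-Reasoning; open IsCRC1 crc
  outside : lineSum (not ∘ C) x ≡ β
  outside = begin
    lineSum (not ∘ C) x                           ≡⟨ sym (neighbours (not ∘ C) x) ⟩
    outNbrs C x + 3 * ind (not (C x))            ≡⟨ cong₂ (λ n b → n + 3 * ind (not b)) (βreg x Cx) Cx ⟩
    β + 0                                         ≡⟨ +-identityʳ β ⟩
    β                                             ∎
  rearrange : ∀ β γ q → β + γ + q ≡ γ + q * 1 + β
  rearrange = solve-∀

colCount rowCount : ∀ {q} → (Fin q → Fin q → Bool) → Fin q → ℕ
colCount D v = count (λ u → D u v)
rowCount D u = count (λ v → D u v)

total : ∀ {q} → (Fin q → Fin q → Bool) → ℕ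
total D = sumFin (rowCount D)

total-by-columns : ∀ {q} (D : Fin q → Fin q → Bool) → sumFin (colCount D) ≡ total D
total-by-columns D = sym (sumFin-swap (λ u v → ind (D u v)))

total-pos : ∀ {q} (D : Fin q → Fin q → Bool) → 0 < total D → ∃[ u ] ∃[ v ] D u v ≡ true
total-pos D pos = let (u , rowPos) = sumFin-pos (rowCount D) pos in u , count-pos (D u) rowPos

biregular : ∀ {q} {X Y : Subset q} {D : Fin q → Fin q → Bool} {r s} →
  (∀ u v → D u v ≡ true → X u ≡ true × Y v ≡ true) →
  (∀ v → Y v ≡ true → colCount D v ≡ r) →
  (∀ u → X u ≡ true → rowCount D u ≡ s) →
  Biregular X Y D r s
biregular {X = X} {Y} {D} supp col row =
  supp ,
  (λ v Yv → trans (count-∧-supported X (λ u → D u v) (λ u → proj₁ ∘ supp u v)) (col v Yv)) ,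
  (λ u Xu → trans (count-∧-supported Y (D u) (λ v → proj₂ ∘ supp u v)) (row u Xu))

-- p i v (r j v): line i of the first (line j of the second) family lies in plane v.
-- Lines of different families in one plane meet, hence cannot both be present.
module Plane {q n : ℕ} (p r : Fin q → Fin q → Bool)
  (disjoint : ∀ i j v → p i v ≡ true → r j v ≡ true → ⊥)
  (total-count : ∀ v → colCount p v + colCount r v ≡ n) where

  occupied : Subset q
  occupied v = does (0 <? colCount p v)

  occupied-intro : ∀ i v → p i v ≡ true → occupied v ≡ true
  occupied-intro i v pᵢ = dec-true (0 <? colCount p v) (witness⇒count-pos (λ i → p i v) i pᵢ)

  unoccupied-intro : ∀ j v → r j v ≡ true → occupied v ≡ false
  unoccupied-intro j v rⱼ = dec-false (0 <? colCount p v) λ pos →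
    disjoint (proj₁ (count-pos (λ i → p i v) pos)) j v (proj₂ (count-pos (λ i → p i v) pos)) rⱼ

  occupied⇒count : ∀ v → occupied v ≡ true → colCount p v ≡ n
  occupied⇒count v occ = begin
    colCount p v                 ≡⟨ sym (+-identityʳ _) ⟩
    colCount p v + 0             ≡⟨ cong (colCount p v +_) (sym no-r) ⟩
    colCount p v + colCount r v  ≡⟨ total-count v ⟩
    n                            ∎
    where
    open ≡-Reasoning
    pos = does⇒ (0 <? colCount p v) occ
    no-r : colCount r v ≡ 0
    no-r = no-witness⇒count≡0 (λ j → r j v) λ j →
      disjoint (proj₁ (count-pos (λ i → p i v) pos)) j v (proj₂ (count-pos (λ i → p i v) pos))

  unoccupied⇒count : ∀ v → occupied v ≡ false → colCount r v ≡ n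
  unoccupied⇒count v unocc =
    trans (cong (_+ colCount r v) (sym no-p)) (total-count v)
    where
    no-p : colCount p v ≡ 0
    no-p = n≤0⇒n≡0 (≮⇒≥ (does⇒¬ (0 <? colCount p v) unocc))

lookup-injective : ∀ {A : Set} {xs : List A} → Unique xs → ∀ {i j} → lookup xs i ≡ lookup xs j → i ≡ j
lookup-injective (_    ∷ _)  {zero}  {zero}  _ = refl
lookup-injective (x∉xs ∷ _)  {zero}  {suc j} e = ⊥-elim (All.lookup x∉xs (∈-lookup j) e)
lookup-injective (x∉xs ∷ _)  {suc i} {zero}  e = ⊥-elim (All.lookup x∉xs (∈-lookup i) (sym e))
lookup-injective (_    ∷ xs) {suc i} {suc j} e = cong suc (lookup-injective xs e)

enumerate : ∀ {A : Set} (xs : List A) → Unique xs → (∀ x → x ∈ xs) → (P : A → Bool) →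
  ∃[ m ] Σ (Fin m → A) λ e →
    (∀ {i j} → e i ≡ e j → i ≡ j) × (∀ i → P (e i) ≡ true) × (∀ x → P x ≡ true → ∃[ i ] e i ≡ x)
enumerate xs unique complete P =
  length ys , lookup ys ,
  lookup-injective (Unique.filter⁺ P? unique) ,
  (λ i → proj₂ (∈-filter⁻ P? {xs = xs} (∈-lookup i))) ,
  (λ x Px → let x∈ys = ∈-filter⁺ P? (complete x) Px in index x∈ys , sym (lookup-index x∈ys))
  where
  P? = λ x → P x ≟ᵇ true
  ys = filter P? xs

module _ {q : ℕ} where

  allCliques : List (MaxClique q)
  allCliques = map (λ (d , a , b) → clique d a b)
                   (cartesianProduct (allFin 3) (cartesianProduct (allFin q) (allFin q)))

  allCliques-unique : Unique allCliques
  allCliques-unique =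
    Unique.map⁺ (λ { {_ , _ , _} {_ , _ , _} refl → refl })
      (Unique.cartesianProduct⁺ (Unique.allFin⁺ 3) (Unique.cartesianProduct⁺ (Unique.allFin⁺ q) (Unique.allFin⁺ q)))

  allCliques-complete : ∀ K → K ∈ allCliques
  allCliques-complete (clique d a b) =
    ∈-map⁺ _ (∈-cartesianProduct⁺ (∈-allFin d) (∈-cartesianProduct⁺ (∈-allFin a) (∈-allFin b)))

  partition⇒StrongCliqueProperty : ∀ (C : Code q) (P : MaxClique q → Bool) →
    (∀ {K K′ x} → P K ≡ true → P K′ ≡ true → x ∈K K → x ∈K K′ → K ≡ K′) →
    (∀ x → C x ≡ true ⇔ (∃[ K ] P K ≡ true × x ∈K K)) →
    (∀ d → ∃[ K ] P K ≡ true × codir K ≡ d) →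
    StrongCliqueProperty C
  partition⇒StrongCliqueProperty C P unique cover codirs
    with enumerate allCliques allCliques-unique allCliques-complete P
  ... | m , K , K-injective , K-P , K-onto = m , K , (disjoint , union) , directions
    where
    disjoint : ∀ i j → i ≢ j → ∀ x → ¬ (x ∈K K i × x ∈K K j)
    disjoint i j i≢j x (x∈Kᵢ , x∈Kⱼ) = i≢j (K-injective (unique (K-P i) (K-P j) x∈Kᵢ x∈Kⱼ))

    union : ∀ x → C x ≡ true ⇔ (∃[ i ] x ∈K K i)
    union x = mk⇔
      (λ x∈C → let (K′ , PK′ , x∈K′) = Equivalence.to (cover x) x∈C
                   (i , Kᵢ≡K′) = K-onto K′ PK′
               in i , subst (x ∈K_) (sym Kᵢ≡K′) x∈K′)
      (λ (i , x∈Kᵢ) → Equivalence.from (cover x) (K i , K-P i , x∈Kᵢ))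

    directions : ∀ d → ∃[ i ] codir (K i) ≡ d
    directions d = let (K′ , PK′ , codir≡d) = codirs d
                       (i , Kᵢ≡K′) = K-onto K′ PK′
                   in i , trans (cong codir Kᵢ≡K′) codir≡d

module FullLines {q : ℕ} (C : Code q) {γ : ℕ}
  (lineSums : ∀ x → lineSum C x ≡ γ + q * ind (C x)) (2γ<q : 2 * γ < q) where

  full : MaxClique q → Bool
  full K = does (lineCount C K ≟ℕ q)

  full⊆C : ∀ K {x} → full K ≡ true → x ∈K K → C x ≡ true
  full⊆C K fK x∈K = subst (λ y → C y ≡ true) (proj₂ (∈-point K x∈K))
    (count≡n⇒all (λ t → C (point K t)) (does⇒ (lineCount C K ≟ℕ q) fK) (proj₁ (∈-point K x∈K)))

  not-full⇒small : ∀ K → lineCount C K ≢ q → lineCount C K ≤ γ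
  not-full⇒small K ¬full = begin
    lineCount C K                             ≡⟨ cong (lineCount C) (sym (line-point K t)) ⟩
    lineCount C (line (codir K) (point K t))  ≤⟨ sumFin-term≤ (λ d → lineCount C (line d (point K t))) (codir K) ⟩
    lineSum C (point K t)                     ≡⟨ lineSums (point K t) ⟩
    γ + q * ind (C (point K t))               ≡⟨ cong (λ b → γ + q * ind b) t∉C ⟩
    γ + q * 0                                 ≡⟨ trans (cong (γ +_) (*-zeroʳ q)) (+-identityʳ γ) ⟩
    γ                                         ∎
    where
    open ≤-Reasoning
    t = proj₁ (count≢n⇒missing (λ t → C (point K t)) ¬full)
    t∉C = proj₂ (count≢n⇒missing (λ t → C (point K t)) ¬full)

  fullLineCount : ∀ x → count (λ d → full (line d x)) ≡ ind (C x)
  fullLineCount x = full-summands 2γ<q (λ d → lineCount C (line d x)) (λ d → not-full⇒small (line d x))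
                              (C x) (lineSums x)

  fullLine-unique : ∀ x {d d′} → full (line d x) ≡ true → full (line d′ x) ≡ true → d ≡ d′
  fullLine-unique x = count≤1-unique (λ d → full (line d x)) (subst (_≤ 1) (sym (fullLineCount x)) (ind≤1 (C x)))

  fullLine-through : ∀ x → C x ≡ true → ∃[ d ] full (line d x) ≡ true
  fullLine-through x x∈C = count-pos (λ d → full (line d x))
    (subst (0 <_) (sym (fullLineCount x)) (subst (λ b → 0 < ind b) (sym x∈C) (s≤s z≤n)))

  full-unique : ∀ {K K′ x} → full K ≡ true → full K′ ≡ true → x ∈K K → x ∈K K′ → K ≡ K′
  full-unique {K} {K′} {x} fK fK′ x∈K x∈K′ = begin
    K                  ≡⟨ sym (line-∈ K x∈K) ⟩
    line (codir K) x   ≡⟨ cong (λ d → line d x) (fullLine-unique x (through K x∈K fK) (through K′ x∈K′ fK′)) ⟩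
    line (codir K′) x  ≡⟨ line-∈ K′ x∈K′ ⟩
    K′                 ∎
    where
    open ≡-Reasoning
    through : ∀ L → x ∈K L → full L ≡ true → full (line (codir L) x) ≡ true
    through L x∈L = subst (λ L → full L ≡ true) (sym (line-∈ L x∈L))

  C-union-of-full : ∀ x → C x ≡ true ⇔ (∃[ K ] full K ≡ true × x ∈K K)
  C-union-of-full x = mk⇔
    (λ x∈C → let (d , f) = fullLine-through x x∈C in line d x , f , ∈-line d x)
    (λ (K , fK , x∈K) → full⊆C K fK x∈K)

  D₁ D₂ D₃ : Fin q → Fin q → Bool
  D₁ b c = full (clique 0F b c)
  D₂ a c = full (clique 1F a c)
  D₃ a b = full (clique 2F a b)

  C-by-direction : ∀ x₁ x₂ x₃ →
    C (x₁ , x₂ , x₃) ≡ true ⇔ (D₁ x₂ x₃ ≡ true ⊎ D₂ x₁ x₃ ≡ true ⊎ D₃ x₁ x₂ ≡ true)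
  C-by-direction x₁ x₂ x₃ = mk⇔ (by-direction ∘ fullLine-through x) from
    where
    x = (x₁ , x₂ , x₃)
    by-direction : ∃[ d ] full (line d x) ≡ true → D₁ x₂ x₃ ≡ true ⊎ D₂ x₁ x₃ ≡ true ⊎ D₃ x₁ x₂ ≡ true
    by-direction (0F , f) = inj₁ f
    by-direction (1F , f) = inj₂ (inj₁ f)
    by-direction (2F , f) = inj₂ (inj₂ f)
    from : D₁ x₂ x₃ ≡ true ⊎ D₂ x₁ x₃ ≡ true ⊎ D₃ x₁ x₂ ≡ true → C x ≡ true
    from (inj₁ f)        = full⊆C (line 0F x) f (∈-line 0F x)
    from (inj₂ (inj₁ f)) = full⊆C (line 1F x) f (∈-line 1F x)
    from (inj₂ (inj₂ f)) = full⊆C (line 2F x) f (∈-line 2F x)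

  decomposition : ∀ a b c → ind (C (a , b , c)) ≡ ind (D₁ b c) + ind (D₂ a c) + ind (D₃ a b)
  decomposition a b c = trans (sym (fullLineCount (a , b , c))) (sumFin-3 (λ d → ind (full (line d (a , b , c)))))

  lineCount₁ : ∀ b c → lineCount C (clique 0F b c) ≡ q * ind (D₁ b c) + colCount D₂ c + colCount D₃ b
  lineCount₁ b c = begin
    sumFin (λ a → ind (C (a , b , c)))
      ≡⟨ sumFin-cong (λ a → decomposition a b c) ⟩
    sumFin (λ a → ind (D₁ b c) + ind (D₂ a c) + ind (D₃ a b))
      ≡⟨ sumFin-+₃ (λ _ → ind (D₁ b c)) (λ a → ind (D₂ a c)) (λ a → ind (D₃ a b)) ⟩
    sumFin {q} (λ _ → ind (D₁ b c)) + colCount D₂ c + colCount D₃ b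
      ≡⟨ cong (λ n → n + colCount D₂ c + colCount D₃ b) (sumFin-const {q} (ind (D₁ b c))) ⟩
    q * ind (D₁ b c) + colCount D₂ c + colCount D₃ b ∎
    where open ≡-Reasoning

  lineCount₂ : ∀ a c → lineCount C (clique 1F a c) ≡ colCount D₁ c + q * ind (D₂ a c) + rowCount D₃ a
  lineCount₂ a c = begin
    sumFin (λ b → ind (C (a , b , c)))
      ≡⟨ sumFin-cong (λ b → decomposition a b c) ⟩
    sumFin (λ b → ind (D₁ b c) + ind (D₂ a c) + ind (D₃ a b))
      ≡⟨ sumFin-+₃ (λ b → ind (D₁ b c)) (λ _ → ind (D₂ a c)) (λ b → ind (D₃ a b)) ⟩
    colCount D₁ c + sumFin {q} (λ _ → ind (D₂ a c)) + rowCount D₃ a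
      ≡⟨ cong (λ n → colCount D₁ c + n + rowCount D₃ a) (sumFin-const {q} (ind (D₂ a c))) ⟩
    colCount D₁ c + q * ind (D₂ a c) + rowCount D₃ a ∎
    where open ≡-Reasoning

  lineCount₃ : ∀ a b → lineCount C (clique 2F a b) ≡ rowCount D₁ b + rowCount D₂ a + q * ind (D₃ a b)
  lineCount₃ a b = begin
    sumFin (λ c → ind (C (a , b , c)))
      ≡⟨ sumFin-cong (λ c → decomposition a b c) ⟩
    sumFin (λ c → ind (D₁ b c) + ind (D₂ a c) + ind (D₃ a b))
      ≡⟨ sumFin-+₃ (λ c → ind (D₁ b c)) (λ c → ind (D₂ a c)) (λ _ → ind (D₃ a b)) ⟩
    rowCount D₁ b + rowCount D₂ a + sumFin {q} (λ _ → ind (D₃ a b))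
      ≡⟨ cong (rowCount D₁ b + rowCount D₂ a +_) (sumFin-const {q} (ind (D₃ a b))) ⟩
    rowCount D₁ b + rowCount D₂ a + q * ind (D₃ a b) ∎
    where open ≡-Reasoning

  planeCount₁ planeCount₂ planeCount₃ : Fin q → ℕ
  planeCount₁ a = rowCount D₂ a + rowCount D₃ a
  planeCount₂ b = rowCount D₁ b + colCount D₃ b
  planeCount₃ c = colCount D₁ c + colCount D₂ c

  -- Expand the line sum through (a, b, c) by the decomposition: the q·[x ∈ C] terms cancel.
  planeCounts : ∀ a b c → planeCount₁ a + planeCount₂ b + planeCount₃ c ≡ γ
  planeCounts a b c = +-cancelʳ-≡ (q * ind (C x)) _ _ (begin
    planeCount₁ a + planeCount₂ b + planeCount₃ c + q * ind (C x)
      ≡⟨ cong (λ n → planeCount₁ a + planeCount₂ b + planeCount₃ c + q * n) (decomposition a b c) ⟩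
    planeCount₁ a + planeCount₂ b + planeCount₃ c + q * (ind (D₁ b c) + ind (D₂ a c) + ind (D₃ a b))
      ≡⟨ regroup q (ind (D₁ b c)) (ind (D₂ a c)) (ind (D₃ a b))
                 (colCount D₁ c) (colCount D₂ c) (colCount D₃ b) (rowCount D₁ b) (rowCount D₂ a) (rowCount D₃ a) ⟩
    (q * ind (D₁ b c) + colCount D₂ c + colCount D₃ b) + (colCount D₁ c + q * ind (D₂ a c) + rowCount D₃ a)
      + (rowCount D₁ b + rowCount D₂ a + q * ind (D₃ a b))
      ≡⟨ sym (cong₂ _+_ (cong₂ _+_ (lineCount₁ b c) (lineCount₂ a c)) (lineCount₃ a b)) ⟩
    lineCount C (clique 0F b c) + lineCount C (clique 1F a c) + lineCount C (clique 2F a b)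
      ≡⟨ sym (sumFin-3 (λ d → lineCount C (line d x))) ⟩
    lineSum C x
      ≡⟨ lineSums x ⟩
    γ + q * ind (C x) ∎)
    where
    open ≡-Reasoning
    x = (a , b , c)
    regroup : ∀ q d₁ d₂ d₃ c₁ c₂ c₃ r₁ r₂ r₃ →
      r₂ + r₃ + (r₁ + c₃) + (c₁ + c₂) + q * (d₁ + d₂ + d₃)
      ≡ (q * d₁ + c₂ + c₃) + (c₁ + q * d₂ + r₃) + (r₁ + r₂ + q * d₃)
    regroup = solve-∀

  0<q : 0 < q
  0<q = ≤-trans (s≤s z≤n) 2γ<q

  origin : Fin q
  origin = fromℕ< 0<q

  a₀ b₀ c₀ : ℕ
  a₀ = planeCount₃ origin
  b₀ = planeCount₂ origin
  c₀ = planeCount₁ origin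

  planeCount₃-const : ∀ c → planeCount₃ c ≡ a₀
  planeCount₃-const c = +-cancelˡ-≡ (c₀ + b₀) _ _
    (trans (planeCounts origin origin c) (sym (planeCounts origin origin origin)))

  planeCount₂-const : ∀ b → planeCount₂ b ≡ b₀
  planeCount₂-const b = +-cancelˡ-≡ c₀ _ _ (+-cancelʳ-≡ a₀ _ _
    (trans (planeCounts origin b origin) (sym (planeCounts origin origin origin))))

  planeCount₁-const : ∀ a → planeCount₁ a ≡ c₀
  planeCount₁-const a = +-cancelʳ-≡ b₀ _ _ (+-cancelʳ-≡ a₀ _ _
    (trans (planeCounts a origin origin) (sym (planeCounts origin origin origin))))

  total₁₂ : total D₁ + total D₂ ≡ q * a₀
  total₁₂ = begin
    total D₁ + total D₂                          ≡⟨ sym (cong₂ _+_ (total-by-columns D₁) (total-by-columns D₂)) ⟩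
    sumFin (colCount D₁) + sumFin (colCount D₂)  ≡⟨ sym (sumFin-+ (colCount D₁) (colCount D₂)) ⟩
    sumFin planeCount₃                           ≡⟨ sumFin-constant planeCount₃-const ⟩
    q * a₀                                       ∎
    where open ≡-Reasoning

  total₁₃ : total D₁ + total D₃ ≡ q * b₀
  total₁₃ = begin
    total D₁ + total D₃                  ≡⟨ cong (total D₁ +_) (sym (total-by-columns D₃)) ⟩
    total D₁ + sumFin (colCount D₃)      ≡⟨ sym (sumFin-+ (rowCount D₁) (colCount D₃)) ⟩
    sumFin planeCount₂                   ≡⟨ sumFin-constant planeCount₂-const ⟩
    q * b₀                               ∎
    where open ≡-Reasoning

  total₂₃ : total D₂ + total D₃ ≡ q * c₀
  total₂₃ = trans (sym (sumFin-+ (rowCount D₂) (rowCount D₃))) (sumFin-constant planeCount₁-const)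

  distinct-full : ∀ x d d′ → d ≢ d′ → full (line d x) ≡ true → full (line d′ x) ≡ true → ⊥
  distinct-full x d d′ d≢d′ f f′ = d≢d′ (fullLine-unique x f f′)

  module Plane₁ = Plane (λ c a → D₂ a c) (λ b a → D₃ a b)
    (λ c b a → distinct-full (a , b , c) 1F 2F (λ ())) planeCount₁-const
  module Plane₂ = Plane (λ c b → D₁ b c) (λ a b → D₃ a b)
    (λ c a b → distinct-full (a , b , c) 0F 2F (λ ())) planeCount₂-const
  module Plane₃ = Plane (λ b c → D₁ b c) (λ a c → D₂ a c)
    (λ b a c → distinct-full (a , b , c) 0F 1F (λ ())) planeCount₃-const

  R S T : Subset q
  R = Plane₁.occupied
  S = Plane₂.occupied
  T = Plane₃.occupied

  D₁-biregular : Biregular S T D₁ a₀ b₀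
  D₁-biregular = biregular
    (λ u v D₁uv → Plane₂.occupied-intro v u D₁uv , Plane₃.occupied-intro u v D₁uv)
    Plane₃.occupied⇒count Plane₂.occupied⇒count

  D₂-biregular : Biregular R (compl T) D₂ a₀ c₀
  D₂-biregular = biregular
    (λ u v D₂uv → Plane₁.occupied-intro v u D₂uv , cong not (Plane₃.unoccupied-intro u v D₂uv))
    (λ v T̄v → Plane₃.unoccupied⇒count v (not-injective T̄v)) Plane₁.occupied⇒count

  D₃-biregular : Biregular (compl R) (compl S) D₃ b₀ c₀
  D₃-biregular = biregular
    (λ u v D₃uv → cong not (Plane₁.unoccupied-intro v u D₃uv) , cong not (Plane₂.unoccupied-intro u v D₃uv))
    (λ v S̄v → Plane₂.unoccupied⇒count v (not-injective S̄v))
    (λ u R̄u → Plane₁.unoccupied⇒count u (not-injective R̄u))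

  module _ (γ-odd : γ % 2 ≡ 1) where

    full-in-every-direction : 0 < total D₁ × 0 < total D₂ × 0 < total D₃
    full-in-every-direction = pairwise-sums-positive q {{>-nonZero 0<q}} total₁₂ total₁₃ total₂₃
      (trans (cong (_% 2) (trans (reverse a₀ b₀ c₀) (planeCounts origin origin origin))) γ-odd)
      where
      reverse : ∀ a b c → a + b + c ≡ c + b + a
      reverse = solve-∀

    full₁ : ∃[ b ] ∃[ c ] D₁ b c ≡ true
    full₁ = total-pos D₁ (proj₁ full-in-every-direction)
    full₂ : ∃[ a ] ∃[ c ] D₂ a c ≡ true
    full₂ = total-pos D₂ (proj₁ (proj₂ full-in-every-direction))
    full₃ : ∃[ a ] ∃[ b ] D₃ a b ≡ true
    full₃ = total-pos D₃ (proj₂ (proj₂ full-in-every-direction))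

    strongCliqueProperty : StrongCliqueProperty C
    strongCliqueProperty = partition⇒StrongCliqueProperty C full full-unique C-union-of-full directions
      where
      directions : ∀ d → ∃[ K ] full K ≡ true × codir K ≡ d
      directions 0F = let (b , c , f) = full₁ in clique 0F b c , f , refl
      directions 1F = let (a , c , f) = full₂ in clique 1F a c , f , refl
      directions 2F = let (a , b , f) = full₃ in clique 2F a b , f , refl

    constructionD : ConstructionD C
    constructionD =
      R , S , T , R-nonempty-proper , S-nonempty-proper , T-nonempty-proper ,
      a₀ , b₀ , c₀ ,
      positive-quotient q (proj₁ full-in-every-direction) total₁₂ ,
      positive-quotient q (proj₁ full-in-every-direction) total₁₃ ,
      positive-quotient q (proj₁ (proj₂ full-in-every-direction)) total₂₃ ,
      D₁ , D₂ , D₃ , D₁-biregular , D₂-biregular , D₃-biregular , C-by-direction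
      where
      b₁ = proj₁ full₁ ; c₁ = proj₁ (proj₂ full₁) ; f₁ = proj₂ (proj₂ full₁)
      a₂ = proj₁ full₂ ; c₂ = proj₁ (proj₂ full₂) ; f₂ = proj₂ (proj₂ full₂)
      a₃ = proj₁ full₃ ; b₃ = proj₁ (proj₂ full₃) ; f₃ = proj₂ (proj₂ full₃)
      R-nonempty-proper : NonemptyProper R
      R-nonempty-proper = (a₂ , Plane₁.occupied-intro c₂ a₂ f₂) , (a₃ , Plane₁.unoccupied-intro b₃ a₃ f₃)
      S-nonempty-proper : NonemptyProper S
      S-nonempty-proper = (b₁ , Plane₂.occupied-intro c₁ b₁ f₁) , (b₃ , Plane₂.unoccupied-intro a₃ b₃ f₃)
      T-nonempty-proper : NonemptyProper T
      T-nonempty-proper = (c₁ , Plane₃.occupied-intro b₁ c₁ f₁) , (c₂ , Plane₃.unoccupied-intro a₂ c₂ f₂)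

theorem5 : (q : ℕ) → 2 ≤ q → (C : Code q) → (β γ : ℕ) →
    IsCRC1 C β γ → β + γ ≡ 2 * q → γ % 2 ≡ 1 → 2 * γ < q →
    StrongCliqueProperty C × ConstructionD C
theorem5 q _ C β γ crc β+γ≡2q γ-odd 2γ<q =
  strongCliqueProperty γ-odd , constructionD γ-odd
  where open FullLines C (lineSum-crc crc β+γ≡2q) 2γ<q
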